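{- Let $G$ be a graph, $d\ge1$, $m\ge 0$ and $r\ge1$ integers. If every subgraph of $G$ with diameter at most $d$ has at most $m$ edges, then every subgraph of $G(r)$ with diameter at most $d$ has at most $r^2m$ edges.
   Context: For a graph $G$ with vertices $v_1,\dots,v_N$, the blow-up $G(r)$ is the graph obtained by replacing each $v_i$ by an independent set $V_i$ of size $r$, where $u\in V_i$ and $w\in V_j$ are adjacent iff $v_i$ and $v_j$ are adjacent in $G$. The diameter of a graph is the maximum distance between two vertices ($\infty$ if disconnected). -}

module Defs where

open import Data.Nat using (ℕ; zero; suc; _+_; _*_; _≤_; _<ᵇ_)
open import Data.Fin using (Fin; toℕ; quotient)
open import Data.Bool using (Bool; true; false; _∧_; if_then_else_)
open import Data.List using (List; map)
open import Data.Nat.ListAction using (sum)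
open import Relation.Binary.PropositionalEquality using (_≡_)

open import Data.List using (allFin)

record Graph (n : ℕ) : Set where
  field
    adj    : Fin n → Fin n → Bool
    sym    : ∀ u v → adj u v ≡ adj v u
    irrefl : ∀ u → adj u u ≡ false
open Graph public

-- A (not necessarily induced) subgraph of G: a vertex subset and an edge
-- subset, every chosen edge being an edge of G with both ends chosen.
record Subgraph {n : ℕ} (G : Graph n) : Set where
  field
    verts     : Fin n → Bool
    edges     : Fin n → Fin n → Bool
    edges-sym : ∀ u v → edges u v ≡ edges v u
    edges⊆G   : ∀ u v → edges u v ≡ true → adj G u v ≡ true
    edges-end : ∀ u v → edges u v ≡ true → verts u ≡ true
open Subgraph public

data WalkLE {n : ℕ} (E : Fin n → Fin n → Bool) : ℕ → Fin n → Fin n → Set where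
  here : ∀ {k u} → WalkLE E k u u
  step : ∀ {k u v w} → E u v ≡ true → WalkLE E k v w → WalkLE E (suc k) u w

-- diam(H) ≤ d : any two vertices of H are joined in H by a walk of length ≤ d
-- (equivalently their distance in H is ≤ d; disconnected means diameter ∞).
DiamLE : {n : ℕ} {G : Graph n} → Subgraph G → ℕ → Set
DiamLE {n} H d = ∀ (u v : Fin n) → verts H u ≡ true → verts H v ≡ true →
  WalkLE (edges H) d u v

edgeCount : {n : ℕ} {G : Graph n} → Subgraph G → ℕ
edgeCount {n} H =
  sum (map (λ u → sum (map (λ v →
      if (toℕ u <ᵇ toℕ v) ∧ edges H u v then 1 else 0) (allFin n))) (allFin n))

-- Blow-up G(r): vertex x of Fin (N * r) lies in class V_i with i = quotient r x;
-- x ~ y iff their classes are adjacent in G.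
blowUp : {N : ℕ} → Graph N → (r : ℕ) → Graph (N * r)
blowUp {N} G r = record
  { adj    = λ x y → adj G (quotient r x) (quotient r y)
  ; sym    = λ x y → sym G (quotient r x) (quotient r y)
  ; irrefl = λ x → irrefl G (quotient r x)
  }

-- Project a subgraph H of G(r) to the subgraph H′ of G whose vertices and edges
-- are the classes and the pairs of classes met by H. A walk in H projects to a
-- walk of the same length in H′, so H′ has diameter at most d and hence at most
-- m edges. Every edge of H joins two distinct classes (the classes are
-- independent), so it projects to an edge of H′, and a pair of classes carries
-- only r² pairs of vertices; hence H has at most r²m edges.
module Submission where

open import Defs hiding (sym)
open import Data.Bool as Bool using (Bool; true; false; T; if_then_else_; _∧_)
open import Data.Bool.Properties using (T-≡; T-∧)
open import Data.Fin as Fin using (Fin; zero; suc; toℕ; quotient; remainder; combine; _↑ˡ_; _↑ʳ_)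
open import Data.Fin.Properties as Finₚ using (any?; combine-remQuot; remQuot-combine; toℕ-combine; toℕ<n)
open import Data.List using (allFin; map; tabulate)
open import Data.List.Properties using (map-tabulate)
open import Data.Nat using (ℕ; zero; suc; _+_; _*_; _^_; _≤_; _<ᵇ_; z≤n)
open import Data.Nat.ListAction as ListAction using ()
open import Data.Nat.Properties
open import Algebra.Properties.Semiring.Sum +-*-semiring using (sum; sum-syntax; sum-cong-≗; *-distribˡ-sum)
open import Data.Product using (∃; _×_; _,_; proj₁; proj₂)
open import Function using (_∘_; Equivalence; mk⇔)
open import Relation.Binary using (tri<; tri≈; tri>)
open import Relation.Binary.PropositionalEquality
open import Relation.Nullary using (Dec; does; yes; contradiction)
open import Relation.Nullary.Decidable using (_×-dec_; dec-true; does-⇔)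

sum-tabulate : ∀ {n} (f : Fin n → ℕ) → ListAction.sum (tabulate f) ≡ sum f
sum-tabulate {zero}  f = refl
sum-tabulate {suc n} f = cong (f zero +_) (sum-tabulate (f ∘ suc))

sum-map-allFin : ∀ {n} (f : Fin n → ℕ) → ListAction.sum (map f (allFin n)) ≡ sum f
sum-map-allFin f = trans (cong ListAction.sum (map-tabulate (λ i → i) f)) (sum-tabulate f)

sum-mono-≤ : ∀ {n} {f g : Fin n → ℕ} → (∀ i → f i ≤ g i) → sum f ≤ sum g
sum-mono-≤ {zero}  f≤g = z≤n
sum-mono-≤ {suc n} f≤g = +-mono-≤ (f≤g zero) (sum-mono-≤ (f≤g ∘ suc))

sum-const : ∀ n c → ∑[ _ < n ] c ≡ n * c
sum-const zero    c = refl
sum-const (suc n) c = cong (c +_) (sum-const n c)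

sum-++ : ∀ m {n} (f : Fin (m + n) → ℕ) →
  sum f ≡ ∑[ i < m ] f (i ↑ˡ n) + ∑[ j < n ] f (m ↑ʳ j)
sum-++ zero    f = refl
sum-++ (suc m) f = trans (cong (f zero +_) (sum-++ m (f ∘ suc))) (sym (+-assoc (f zero) _ _))

sum-combine : ∀ m n (f : Fin (m * n) → ℕ) → sum f ≡ ∑[ i < m ] ∑[ j < n ] f (combine i j)
sum-combine zero    n f = refl
sum-combine (suc m) n f =
  trans (sum-++ n f) (cong (sum (λ j → f (j ↑ˡ (m * n))) +_) (sum-combine m n (f ∘ (n ↑ʳ_))))

quotient-combine : ∀ {m n} (i : Fin m) (j : Fin n) → quotient n (combine i j) ≡ i
quotient-combine i j = cong proj₁ (remQuot-combine i j)

sum-quotient : ∀ {N} r (h : Fin N → ℕ) → ∑[ x < N * r ] h (quotient r x) ≡ r * sum h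
sum-quotient {N} r h = begin
  ∑[ x < N * r ] h (quotient r x)
    ≡⟨ sum-combine N r (h ∘ quotient r) ⟩
  ∑[ i < N ] ∑[ j < r ] h (quotient r (combine i j))
    ≡⟨ sum-cong-≗ {N} (λ i → sum-cong-≗ {r} (λ j → cong h (quotient-combine i j))) ⟩
  ∑[ i < N ] ∑[ j < r ] h i
    ≡⟨ sum-cong-≗ {N} (λ i → sum-const r (h i)) ⟩
  ∑[ i < N ] (r * h i)
    ≡⟨ *-distribˡ-sum r h ⟨
  r * sum h
    ∎
  where open ≡-Reasoning

sum²-quotient : ∀ {N} r (h : Fin N → Fin N → ℕ) →
  ∑[ x < N * r ] ∑[ y < N * r ] h (quotient r x) (quotient r y) ≡
  r ^ 2 * ∑[ i < N ] ∑[ j < N ] h i j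
sum²-quotient {N} r h = begin
  ∑[ x < N * r ] ∑[ y < N * r ] h (quotient r x) (quotient r y)
    ≡⟨ sum-cong-≗ {N * r} (λ x → sum-quotient r (h (quotient r x))) ⟩
  ∑[ x < N * r ] (r * ∑[ j < N ] h (quotient r x) j)
    ≡⟨ *-distribˡ-sum r (λ x → ∑[ j < N ] h (quotient r x) j) ⟨
  r * ∑[ x < N * r ] ∑[ j < N ] h (quotient r x) j
    ≡⟨ cong (r *_) (sum-quotient r (λ i → ∑[ j < N ] h i j)) ⟩
  r * (r * ∑[ i < N ] ∑[ j < N ] h i j)
    ≡⟨ *-assoc r r _ ⟨
  r * r * ∑[ i < N ] ∑[ j < N ] h i j
    ≡⟨ cong (λ s → r * s * _) (*-identityʳ r) ⟨
  r ^ 2 * ∑[ i < N ] ∑[ j < N ] h i j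
    ∎
  where open ≡-Reasoning

combine-monoˡ-< : ∀ {m n} {i i′ : Fin m} (j j′ : Fin n) →
  i Fin.< i′ → combine i j Fin.< combine i′ j′
combine-monoˡ-< {n = n} {i} {i′} j j′ i<i′ = begin-strict
  toℕ (combine i j)       ≡⟨ toℕ-combine i j ⟩
  n * toℕ i + toℕ j       <⟨ +-monoʳ-< (n * toℕ i) (toℕ<n j) ⟩
  n * toℕ i + n           ≡⟨ trans (*-suc n (toℕ i)) (+-comm n (n * toℕ i)) ⟨
  n * suc (toℕ i)         ≤⟨ *-monoʳ-≤ n i<i′ ⟩
  n * toℕ i′              ≤⟨ m≤m+n (n * toℕ i′) (toℕ j′) ⟩
  n * toℕ i′ + toℕ j′     ≡⟨ toℕ-combine i′ j′ ⟨
  toℕ (combine i′ j′)     ∎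
  where open ≤-Reasoning

quotient-<⇒< : ∀ {N} r (x y : Fin (N * r)) →
  quotient {N} r x Fin.< quotient {N} r y → x Fin.< y
quotient-<⇒< {N} r x y q<q = subst₂ Fin._<_ (combine-remQuot {N} r x) (combine-remQuot {N} r y)
  (combine-monoˡ-< (remainder {N} r x) (remainder {N} r y) q<q)

quotient-<-≢ : ∀ {N} r {x y : Fin (N * r)} → x Fin.< y → quotient {N} r x ≢ quotient {N} r y →
  quotient {N} r x Fin.< quotient {N} r y
quotient-<-≢ {N} r {x} {y} x<y q≢q with Finₚ.<-cmp (quotient {N} r x) (quotient {N} r y)
... | tri< q<q _ _ = q<q
... | tri≈ _ q≡q _ = contradiction q≡q q≢q
... | tri> _ _ q>q = contradiction (quotient-<⇒< r y x q>q) (<-asym x<y)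

does≡true⇒ : ∀ {a} {A : Set a} (a? : Dec A) → does a? ≡ true → A
does≡true⇒ (yes a) _ = a

adj⇒≢ : ∀ {n} (G : Graph n) {u v : Fin n} → adj G u v ≡ true → u ≢ v
adj⇒≢ G {u} uv refl with () ← trans (sym uv) (irrefl G u)

module _ {M N} {G′ : Graph M} {G : Graph N} (φ : Fin M → Fin N)
         (φ-hom : ∀ x y → adj G′ x y ≡ true → adj G (φ x) (φ y) ≡ true)
         (H : Subgraph G′) where

  VertexOver : Fin N → Set
  VertexOver i = ∃ λ x → φ x ≡ i × verts H x ≡ true

  EdgeOver : Fin N → Fin N → Set
  EdgeOver i j = ∃ λ x → ∃ λ y → φ x ≡ i × φ y ≡ j × edges H x y ≡ true

  vertexOver? : ∀ i → Dec (VertexOver i)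
  vertexOver? i = any? λ x → φ x Fin.≟ i ×-dec verts H x Bool.≟ true

  edgeOver? : ∀ i j → Dec (EdgeOver i j)
  edgeOver? i j =
    any? λ x → any? λ y → φ x Fin.≟ i ×-dec φ y Fin.≟ j ×-dec edges H x y Bool.≟ true

  EdgeOver-swap : ∀ i j → EdgeOver i j → EdgeOver j i
  EdgeOver-swap i j (x , y , φx≡i , φy≡j , xy) = y , x , φy≡j , φx≡i , trans (edges-sym H y x) xy

  EdgeOver⇒adj : ∀ i j → EdgeOver i j → adj G i j ≡ true
  EdgeOver⇒adj _ _ (x , y , refl , refl , xy) = φ-hom x y (edges⊆G H x y xy)

  EdgeOver⇒VertexOver : ∀ i j → EdgeOver i j → VertexOver i
  EdgeOver⇒VertexOver _ _ (x , y , φx≡i , _ , xy) = x , φx≡i , edges-end H x y xy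

  image : Subgraph G
  image = record
    { verts     = λ i → does (vertexOver? i)
    ; edges     = λ i j → does (edgeOver? i j)
    ; edges-sym = λ i j →
        does-⇔ (mk⇔ (EdgeOver-swap i j) (EdgeOver-swap j i)) (edgeOver? i j) (edgeOver? j i)
    ; edges⊆G   = λ i j ij → EdgeOver⇒adj i j (edgeOver i j ij)
    ; edges-end = λ i j ij → dec-true (vertexOver? i) (EdgeOver⇒VertexOver i j (edgeOver i j ij))
    }
    where
    edgeOver : ∀ i j → does (edgeOver? i j) ≡ true → EdgeOver i j
    edgeOver i j = does≡true⇒ (edgeOver? i j)

  image-edge : ∀ {x y} → edges H x y ≡ true → edges image (φ x) (φ y) ≡ true
  image-edge {x} {y} xy = dec-true (edgeOver? (φ x) (φ y)) (x , y , refl , refl , xy)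

  map-WalkLE : ∀ {k x y} → WalkLE (edges H) k x y → WalkLE (edges image) k (φ x) (φ y)
  map-WalkLE here         = here
  map-WalkLE (step xy w) = step (image-edge xy) (map-WalkLE w)

  image-DiamLE : ∀ {d} → DiamLE H d → DiamLE image d
  image-DiamLE D i j i∈ j∈
    with x , refl , x∈ ← does≡true⇒ (vertexOver? i) i∈
       | y , refl , y∈ ← does≡true⇒ (vertexOver? j) j∈
    = map-WalkLE (D x y x∈ y∈)

indicator : Bool → ℕ
indicator b = if b then 1 else 0

indicator-mono : ∀ {a b} → (T a → T b) → indicator a ≤ indicator b
indicator-mono {false}         _   = z≤n
indicator-mono {true}  {true}  _   = ≤-refl
indicator-mono {true}  {false} a⇒b with () ← a⇒b _

counted : ∀ {n} {G : Graph n} → Subgraph G → Fin n → Fin n → Bool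
counted H u v = (toℕ u <ᵇ toℕ v) ∧ edges H u v

edgeCount≡sum : ∀ {n} {G : Graph n} (H : Subgraph G) →
  edgeCount H ≡ ∑[ u < n ] ∑[ v < n ] indicator (counted H u v)
edgeCount≡sum {n} H =
  trans (sum-map-allFin (λ u → ListAction.sum (map (entry u) (allFin n))))
        (sum-cong-≗ {n} (λ u → sum-map-allFin (entry u)))
  where
  entry : Fin n → Fin n → ℕ
  entry u v = indicator (counted H u v)

module _ {N} (G : Graph N) (r : ℕ) (H : Subgraph (blowUp G r)) where

  quotient-hom : ∀ x y → adj (blowUp G r) x y ≡ true →
                 adj G (quotient {N} r x) (quotient {N} r y) ≡ true
  quotient-hom _ _ xy = xy

  projection : Subgraph G
  projection = image (quotient {N} r) quotient-hom H

  projection-edge : ∀ {x y} → edges H x y ≡ true →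
                    edges projection (quotient {N} r x) (quotient {N} r y) ≡ true
  projection-edge = image-edge {G = G} (quotient {N} r) quotient-hom H

  projection-DiamLE : ∀ {d} → DiamLE H d → DiamLE projection d
  projection-DiamLE = image-DiamLE {G = G} (quotient {N} r) quotient-hom H

  counted-projection : ∀ x y → T (counted H x y) →
                       T (counted projection (quotient {N} r x) (quotient {N} r y))
  counted-projection x y counted-xy = Equivalence.from T-∧
    ( <⇒<ᵇ (quotient-<-≢ r x<y (adj⇒≢ G (edges⊆G H x y xy)))
    , Equivalence.from T-≡ (projection-edge xy) )
    where
    x<y : x Fin.< y
    x<y = <ᵇ⇒< (toℕ x) (toℕ y) (proj₁ (Equivalence.to T-∧ counted-xy))
    xy : edges H x y ≡ true
    xy = Equivalence.to T-≡ (proj₂ (Equivalence.to T-∧ counted-xy))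

  edgeCount-blowUp : edgeCount H ≤ r ^ 2 * edgeCount projection
  edgeCount-blowUp = begin
    edgeCount H
      ≡⟨ edgeCount≡sum H ⟩
    ∑[ x < N * r ] ∑[ y < N * r ] indicator (counted H x y)
      ≤⟨ sum-mono-≤ {N * r} (λ x → sum-mono-≤ {N * r} (λ y →
           indicator-mono (counted-projection x y))) ⟩
    ∑[ x < N * r ] ∑[ y < N * r ] indicator (counted projection (quotient {N} r x) (quotient {N} r y))
      ≡⟨ sum²-quotient {N} r (λ i j → indicator (counted projection i j)) ⟩
    r ^ 2 * ∑[ i < N ] ∑[ j < N ] indicator (counted projection i j)
      ≡⟨ cong (r ^ 2 *_) (edgeCount≡sum projection) ⟨
    r ^ 2 * edgeCount projection
      ∎
    where open ≤-Reasoning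

-- The bound holds for all d and r.
lemma2p8 : {N : ℕ} (G : Graph N) (d m r : ℕ) → 1 ≤ d → 1 ≤ r →
    ((H : Subgraph G) → DiamLE H d → edgeCount H ≤ m) →
    (H : Subgraph (blowUp G r)) → DiamLE H d → edgeCount H ≤ r ^ 2 * m
lemma2p8 G d m r _ _ bound H diam≤d = begin
  edgeCount H          ≤⟨ edgeCount-blowUp G r H ⟩
  r ^ 2 * edgeCount H′ ≤⟨ *-monoʳ-≤ (r ^ 2) (bound H′ (projection-DiamLE G r H diam≤d)) ⟩
  r ^ 2 * m            ∎
  where
  open ≤-Reasoning
  H′ : Subgraph G
  H′ = projection G r H
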